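{- Let $k\ge 1$ be an integer, let $M=2^{k+1}-1$, let $u,v$ be positive integers with $uv=2^k-1$, and let $i$ be an integer with $0\le i\le k$. Put $p=M+2^{i+1}u=2^{i+1}(2^{k-i}+u)-1$ and $q=M+2^{k-i+1}v=2^{k-i+1}(2^i+v)-1$. If $p$ and $q$ are both prime, then $2^kpq$ is weird.
   Context: $\sigma(n)$ denotes the sum of all positive divisors of $n$. A natural number $n$ is abundant if $\sigma(n)>2n$. The aliquot parts of $n$ are the positive divisors $d$ of $n$ with $d<n$. An abundant number $n$ is pseudoperfect if $n$ equals the sum of the elements of some subset of the aliquot parts of $n$ (each aliquot part used at most once). A natural number $n$ is weird if it is abundant but not pseudoperfect. -}

module Defs where

open import Data.Nat using (ℕ; suc; _+_; _*_; _<_; _<?_)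
open import Data.Nat.Divisibility using (_∣_; _∣?_)
open import Data.List using (List; filter; upTo; map)
open import Data.Nat.ListAction using (sum)
open import Data.List.Relation.Binary.Sublist.Propositional using (_⊆_)
open import Data.Product using (Σ; _×_)
open import Relation.Binary.PropositionalEquality using (_≡_)
open import Relation.Nullary using (¬_)

divisors : ℕ → List ℕ
divisors n = filter (_∣? n) (map suc (upTo n))

σ : ℕ → ℕ
σ n = sum (divisors n)

Abundant : ℕ → Set
Abundant n = 2 * n < σ n

aliquotParts : ℕ → List ℕ
aliquotParts n = filter (_<? n) (divisors n)

-- n is pseudoperfect if abundant and n is the sum of a subset of its aliquot parts.
-- A subset of a repetition-free list is represented as a sublist (each part used at most once).
Pseudoperfect : ℕ → Set
Pseudoperfect n = Abundant n × Σ (List ℕ) (λ S → (S ⊆ aliquotParts n) × (sum S ≡ n))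

Weird : ℕ → Set
Weird n = Abundant n × ¬ Pseudoperfect n

module Submission where

-- Write T = 2^k.  The numbers p, q are distinct primes exceeding 2T, so the
-- aliquot parts of n are exactly the four geometric runs
--     2^a,  p·2^a,  q·2^a  (a ≤ k)   and   pq·2^a  (a < k),
-- whose sum is pq(T − 1) + (2T − 1)(1 + p + q).  The arithmetic shape of p and q
-- gives the identity 2T(p + q) = (p + 1)(q + 1), which turns this sum into n + 2T;
-- hence σ(n) = 2n + 2T and n is abundant.  If a set S of aliquot parts summed to n,
-- its complement C would sum to 2T.  Every element of C is then at most 2T < p, so
-- it is a power of two 2^a with a ≤ k; but distinct such powers sum to at most
-- 2T − 1.  So n is not pseudoperfect.

open import Data.Nat using (ℕ; zero; suc; _+_; _*_; _∸_; _^_; _≤_; _<_; z≤n; s≤s; s≤s⁻¹; NonZero; _<?_; ≢-nonZero⁻¹)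
open import Data.Nat.Properties
open import Algebra.Properties.CommutativeSemigroup +-commutativeSemigroup using (x∙yz≈y∙xz)
open import Algebra.Properties.CommutativeSemigroup *-commutativeSemigroup using () renaming (x∙yz≈y∙xz to *-x∙yz≈y∙xz)
open import Data.Nat.Divisibility
open import Data.Nat.Coprimality using (Coprime; coprime-divisor)
open import Data.Nat.Primality using (Prime; prime[2]; euclidsLemma; prime⇒irreducible; prime⇒nonZero)
open import Data.Nat.ListAction using (sum)
open import Data.Nat.ListAction.Properties using (sum-++)
open import Data.Nat.Tactic.RingSolver using (solve-∀)
open import Data.List using (List; []; _∷_; _++_; map; upTo)
open import Data.List.Membership.Propositional using (_∈_)
open import Data.List.Membership.Propositional.Properties using (∈-∃++; ∈-++⁻; ∈-++⁺ˡ; ∈-++⁺ʳ; ∈-filter⁻; ∈-filter⁺; ∈-map⁺; ∈-upTo⁺)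
open import Data.List.Relation.Unary.Any using (here; there)
open import Data.List.Relation.Unary.All as All using (All; []; _∷_)
open import Data.List.Relation.Unary.AllPairs using ([]; _∷_)
open import Data.List.Relation.Unary.Unique.Propositional using (Unique)
import Data.List.Relation.Unary.Unique.Propositional.Properties as Unique
open import Data.List.Relation.Binary.Disjoint.Propositional using (Disjoint)
open import Data.List.Relation.Binary.Disjoint.Propositional.Properties using () renaming (sym to #-sym)
open import Data.List.Relation.Binary.Sublist.Propositional using (_⊆_; []; _∷_; _∷ʳ_)
open import Data.List.Relation.Binary.Sublist.Propositional.Properties using (All-resp-⊆; Any-resp-⊆)
open import Data.Product using (Σ; _×_; _,_; proj₁; proj₂)
open import Data.Sum using (_⊎_; inj₁; inj₂)
open import Data.Empty using (⊥; ⊥-elim)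
open import Relation.Nullary using (¬_; yes; no)
open import Relation.Binary.PropositionalEquality
open import Defs

unique-sum-≤ : ∀ {xs ys : List ℕ} → Unique xs → (∀ {x} → x ∈ xs → x ∈ ys) → sum xs ≤ sum ys
unique-sum-≤ {[]} _ _ = z≤n
unique-sum-≤ {x ∷ xs} {ys} (x∉xs ∷ uxs) xs⊆ys with ∈-∃++ (xs⊆ys (here refl))
... | A , B , ys≡A++x∷B = begin
    x + sum xs          ≤⟨ +-monoʳ-≤ x (unique-sum-≤ uxs xs⊆A++B) ⟩
    x + sum (A ++ B)    ≡⟨ cong (x +_) (sum-++ A B) ⟩
    x + (sum A + sum B) ≡⟨ x∙yz≈y∙xz x (sum A) (sum B) ⟩
    sum A + (x + sum B) ≡⟨ sym (sum-++ A (x ∷ B)) ⟩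
    sum (A ++ x ∷ B)    ≡⟨ cong sum (sym ys≡A++x∷B) ⟩
    sum ys              ∎
  where
  open ≤-Reasoning
  xs⊆A++B : ∀ {y} → y ∈ xs → y ∈ A ++ B
  xs⊆A++B {y} y∈xs with ∈-++⁻ A (subst (y ∈_) ys≡A++x∷B (xs⊆ys (there y∈xs)))
  ... | inj₁ y∈A         = ∈-++⁺ˡ y∈A
  ... | inj₂ (here y≡x)  = ⊥-elim (All.lookup x∉xs y∈xs (sym y≡x))
  ... | inj₂ (there y∈B) = ∈-++⁺ʳ A y∈B

unique-sum-≡ : ∀ {xs ys : List ℕ} → Unique xs → Unique ys →
  (∀ {x} → x ∈ xs → x ∈ ys) → (∀ {x} → x ∈ ys → x ∈ xs) → sum xs ≡ sum ys
unique-sum-≡ uxs uys xs⊆ys ys⊆xs = ≤-antisym (unique-sum-≤ uxs xs⊆ys) (unique-sum-≤ uys ys⊆xs)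

sublist-complement : ∀ {S L : List ℕ} → S ⊆ L → Σ (List ℕ) λ C → (C ⊆ L) × (sum S + sum C ≡ sum L)
sublist-complement [] = [] , [] , refl
sublist-complement {S} (y ∷ʳ S⊆L) with sublist-complement S⊆L
... | C , C⊆L , e = y ∷ C , refl ∷ C⊆L , trans (x∙yz≈y∙xz (sum S) y (sum C)) (cong (y +_) e)
sublist-complement {x ∷ S} (refl ∷ S⊆L) with sublist-complement S⊆L
... | C , C⊆L , e = C , x ∷ʳ C⊆L , trans (+-assoc x (sum S) (sum C)) (cong (x +_) e)

Unique-resp-⊆ : ∀ {S L : List ℕ} → S ⊆ L → Unique L → Unique S
Unique-resp-⊆ []           u         = u
Unique-resp-⊆ (y ∷ʳ S⊆L)   (_ ∷ u)   = Unique-resp-⊆ S⊆L u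
Unique-resp-⊆ (refl ∷ S⊆L) (x∉L ∷ u) = All-resp-⊆ S⊆L x∉L ∷ Unique-resp-⊆ S⊆L u

∈⇒≤sum : ∀ {x} {xs : List ℕ} → x ∈ xs → x ≤ sum xs
∈⇒≤sum {x} {_ ∷ xs} (here refl) = m≤m+n x (sum xs)
∈⇒≤sum {x} {y ∷ xs} (there x∈xs) = ≤-trans (∈⇒≤sum x∈xs) (m≤n+m (sum xs) y)

separated : ∀ {d} {xs ys : List ℕ} → (∀ {x} → x ∈ xs → d ∣ x) → (∀ {y} → y ∈ ys → ¬ d ∣ y) → Disjoint xs ys
separated d∣xs d∤ys (x∈xs , x∈ys) = d∤ys x∈ys (d∣xs x∈xs)

disjoint-++ : ∀ {xs ys zs : List ℕ} → Disjoint xs ys → Disjoint xs zs → Disjoint xs (ys ++ zs)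
disjoint-++ {ys = ys} xs#ys xs#zs (x∈xs , x∈ys++zs) with ∈-++⁻ ys x∈ys++zs
... | inj₁ x∈ys = xs#ys (x∈xs , x∈ys)
... | inj₂ x∈zs = xs#zs (x∈xs , x∈zs)

doublings : ℕ → ℕ → List ℕ
doublings c zero    = []
doublings c (suc m) = c * 2 ^ m ∷ doublings c m

∈-doublings⁻ : ∀ {x c m} → x ∈ doublings c m → Σ ℕ λ a → a < m × x ≡ c * 2 ^ a
∈-doublings⁻ {m = suc m} (here refl) = m , ≤-refl , refl
∈-doublings⁻ {m = suc m} (there x∈run) with ∈-doublings⁻ x∈run
... | a , a<m , e = a , m<n⇒m<1+n a<m , e

∈-doublings⁺ : ∀ {a c m} → a < m → c * 2 ^ a ∈ doublings c m
∈-doublings⁺ {m = suc m} a<1+m with m<1+n⇒m<n∨m≡n a<1+m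
... | inj₁ a<m  = there (∈-doublings⁺ a<m)
... | inj₂ refl = here refl

sum-doublings : ∀ c m → sum (doublings c m) + c ≡ c * 2 ^ m
sum-doublings c zero    = sym (*-identityʳ c)
sum-doublings c (suc m) = begin
    c * 2 ^ m + sum (doublings c m) + c   ≡⟨ +-assoc (c * 2 ^ m) _ c ⟩
    c * 2 ^ m + (sum (doublings c m) + c) ≡⟨ cong (c * 2 ^ m +_) (sum-doublings c m) ⟩
    c * 2 ^ m + c * 2 ^ m                 ≡⟨ double c (2 ^ m) ⟩
    c * (2 * 2 ^ m)                       ∎
  where
  open ≡-Reasoning
  double : ∀ x y → x * y + x * y ≡ x * (2 * y)
  double = solve-∀

-- For c ≠ 0 the run is strictly decreasing, hence repetition-free.
doublings-unique : ∀ c .{{_ : NonZero c}} m → Unique (doublings c m)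
doublings-unique c zero    = []
doublings-unique c (suc m) = All.tabulate (λ x∈run → top≢ (∈-doublings⁻ x∈run)) ∷ doublings-unique c m
  where
  top≢ : ∀ {x} → (Σ ℕ λ a → a < m × x ≡ c * 2 ^ a) → c * 2 ^ m ≢ x
  top≢ (a , a<m , refl) e = <⇒≢ (*-monoʳ-< c (^-monoʳ-< 2 (s≤s (s≤s z≤n)) a<m)) (sym e)

doublings-multiple : ∀ {x c m} → x ∈ doublings c m → c ∣ x
doublings-multiple x∈run with ∈-doublings⁻ x∈run
... | a , _ , refl = m∣m*n (2 ^ a)

2^-split : ∀ {a k} → a ≤ k → 2 ^ a * 2 ^ (k ∸ a) ≡ 2 ^ k
2^-split {a} {k} a≤k = trans (sym (^-distribˡ-+-* 2 a (k ∸ a))) (cong (2 ^_) (m+[n∸m]≡n a≤k))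

prime-divisor-split : ∀ {r m d} → Prime r → d ∣ r * m → (Σ ℕ λ e → d ≡ r * e × e ∣ m) ⊎ d ∣ m
prime-divisor-split {r} {m} {d} pr d∣rm with r ∣? d
... | yes (divides e d≡er) = inj₁ (e , d≡re , *-cancelˡ-∣ r {{prime⇒nonZero pr}} (subst (_∣ r * m) d≡re d∣rm))
  where
  d≡re : d ≡ r * e
  d≡re = trans d≡er (*-comm e r)
... | no r∤d = inj₂ (coprime-divisor d⊥r d∣rm)
  where
  d⊥r : Coprime d r
  d⊥r (c∣d , c∣r) with prime⇒irreducible pr c∣r
  ... | inj₁ c≡1  = c≡1
  ... | inj₂ refl = ⊥-elim (r∤d c∣d)

divisor-of-2^ : ∀ {d} k → d ∣ 2 ^ k → Σ ℕ λ a → a ≤ k × d ≡ 2 ^ a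
divisor-of-2^ zero    d∣1 = 0 , z≤n , ∣1⇒≡1 d∣1
divisor-of-2^ (suc k) d∣2^k+1 with prime-divisor-split prime[2] d∣2^k+1
... | inj₁ (e , refl , e∣2^k) with divisor-of-2^ k e∣2^k
...   | a , a≤k , refl = suc a , s≤s a≤k , refl
divisor-of-2^ (suc k) _ | inj₂ d∣2^k with divisor-of-2^ k d∣2^k
... | a , a≤k , d≡2^a = a , m≤n⇒m≤1+n a≤k , d≡2^a

prime∤doubling : ∀ {r c} a → Prime r → 2 < r → ¬ r ∣ c → ¬ r ∣ c * 2 ^ a
prime∤doubling {r} zero pr 2<r r∤c r∣c*1 = r∤c (subst (r ∣_) (*-identityʳ _) r∣c*1)
prime∤doubling {r} {c} (suc a) pr 2<r r∤c r∣c*2^a+1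
  with euclidsLemma 2 (c * 2 ^ a) pr (subst (r ∣_) (*-x∙yz≈y∙xz c 2 (2 ^ a)) r∣c*2^a+1)
... | inj₁ r∣2    = <⇒≱ 2<r (∣⇒≤ r∣2)
... | inj₂ r∣rest = prime∤doubling a pr 2<r r∤c r∣rest

prime∤doublings : ∀ {r c m x} → Prime r → 2 < r → ¬ r ∣ c → x ∈ doublings c m → ¬ r ∣ x
prime∤doublings pr 2<r r∤c x∈run with ∈-doublings⁻ x∈run
... | a , _ , refl = prime∤doubling a pr 2<r r∤c

>1⇒∤1 : ∀ {r} → 1 < r → ¬ r ∣ 1
>1⇒∤1 1<r r∣1 = <⇒≢ 1<r (sym (∣1⇒≡1 r∣1))

>1⇒∤prime : ∀ {r s} → 1 < r → Prime s → r ≢ s → ¬ r ∣ s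
>1⇒∤prime 1<r ps r≢s r∣s with prime⇒irreducible ps r∣s
... | inj₁ r≡1 = <⇒≢ 1<r (sym r≡1)
... | inj₂ r≡s = r≢s r≡s

proper-factor : ∀ x c {n} .{{_ : NonZero n}} → 1 < c → x * c ≡ n → x < n
proper-factor x c 1<c refl = m<m*n x c {{m*n≢0⇒m≢0 x}} 1<c

module _ (n : ℕ) .{{_ : NonZero n}} where

  ∈-divisors⁻ : ∀ {x} → x ∈ divisors n → x ∣ n
  ∈-divisors⁻ x∈ = proj₂ (∈-filter⁻ (_∣? n) {xs = map suc (upTo n)} x∈)

  ∈-divisors⁺ : ∀ {x} → x ∣ n → x ∈ divisors n
  ∈-divisors⁺ {zero}  0∣n = ⊥-elim (≢-nonZero⁻¹ n (0∣⇒≡0 0∣n))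
  ∈-divisors⁺ {suc y} x∣n = ∈-filter⁺ (_∣? n) (∈-map⁺ suc (∈-upTo⁺ (∣⇒≤ x∣n))) x∣n

  ∈-aliquotParts⁻ : ∀ {x} → x ∈ aliquotParts n → x ∣ n × x < n
  ∈-aliquotParts⁻ x∈ with ∈-filter⁻ (_<? n) x∈
  ... | x∈divisors , x<n = ∈-divisors⁻ x∈divisors , x<n

  ∈-aliquotParts⁺ : ∀ {x} → x ∣ n → x < n → x ∈ aliquotParts n
  ∈-aliquotParts⁺ x∣n x<n = ∈-filter⁺ (_<? n) (∈-divisors⁺ x∣n) x<n

  divisors-unique : Unique (divisors n)
  divisors-unique = Unique.filter⁺ (_∣? n) (Unique.map⁺ suc-injective (Unique.upTo⁺ n))

  aliquotParts-unique : Unique (aliquotParts n)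
  aliquotParts-unique = Unique.filter⁺ (_<? n) divisors-unique

  σ-aliquot : σ n ≡ n + sum (aliquotParts n)
  σ-aliquot = unique-sum-≡ divisors-unique (n∉aliquot ∷ aliquotParts-unique) divisor→ →divisor
    where
    n∉aliquot : All (n ≢_) (aliquotParts n)
    n∉aliquot = All.tabulate λ x∈ n≡x → <-irrefl (sym n≡x) (proj₂ (∈-aliquotParts⁻ x∈))
    divisor→ : ∀ {x} → x ∈ divisors n → x ∈ n ∷ aliquotParts n
    divisor→ x∈ with ∈-divisors⁻ x∈
    ... | x∣n with m≤n⇒m<n∨m≡n (∣⇒≤ x∣n)
    ...   | inj₁ x<n = there (∈-aliquotParts⁺ x∣n x<n)
    ...   | inj₂ x≡n = here x≡n
    →divisor : ∀ {x} → x ∈ n ∷ aliquotParts n → x ∈ divisors n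
    →divisor (here refl) = ∈-divisors⁺ ∣-refl
    →divisor (there x∈) = ∈-divisors⁺ (proj₁ (∈-aliquotParts⁻ x∈))

  pseudoperfect⇒leftover : Pseudoperfect n →
    Σ (List ℕ) λ C → (C ⊆ aliquotParts n) × (n + sum C ≡ sum (aliquotParts n))
  pseudoperfect⇒leftover (_ , S , S⊆ , sumS≡n) with sublist-complement S⊆
  ... | C , C⊆ , e = C , C⊆ , trans (cong (_+ sum C) (sym sumS≡n)) e

-- A weirdness criterion for n = 2^k·P·Q, where P and Q are distinct primes exceeding
-- 2^(k+1): if 2^(k+1)(P + Q) = (P + 1)(Q + 1), then n is weird.
module TwoPrimes (k P Q : ℕ) (pP : Prime P) (pQ : Prime Q) (P≢Q : P ≢ Q)
                 (2T<P : 2 * 2 ^ k < P) (2T<Q : 2 * 2 ^ k < Q) where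

  n : ℕ
  n = 2 ^ k * P * Q

  instance
    P≢0 : NonZero P
    P≢0 = prime⇒nonZero pP
    Q≢0 : NonZero Q
    Q≢0 = prime⇒nonZero pQ
    PQ≢0 : NonZero (P * Q)
    PQ≢0 = m*n≢0 P Q
    n≢0 : NonZero n
    n≢0 = m*n≢0 (2 ^ k * P) Q {{m*n≢0 (2 ^ k) P {{m^n≢0 2 k}}}}

  2<P : 2 < P
  2<P = ≤-<-trans (*-monoʳ-≤ 2 (m^n>0 2 k)) 2T<P

  2<Q : 2 < Q
  2<Q = ≤-<-trans (*-monoʳ-≤ 2 (m^n>0 2 k)) 2T<Q

  1<P : 1 < P
  1<P = <-trans (s≤s (s≤s z≤n)) 2<P

  1<Q : 1 < Q
  1<Q = <-trans (s≤s (s≤s z≤n)) 2<Q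

  -- P and Q divide neither 1 nor each other; this tells the four runs below apart.
  P∤1 : ¬ P ∣ 1
  P∤1 = >1⇒∤1 1<P

  Q∤1 : ¬ Q ∣ 1
  Q∤1 = >1⇒∤1 1<Q

  P∤Q : ¬ P ∣ Q
  P∤Q = >1⇒∤prime 1<P pQ P≢Q

  Q∤P : ¬ Q ∣ P
  Q∤P = >1⇒∤prime 1<Q pP (λ Q≡P → P≢Q (sym Q≡P))

  -- The aliquot parts of n, as four runs of doublings.
  parts : List ℕ
  parts = doublings (P * Q) k ++ doublings 1 (suc k) ++ doublings P (suc k) ++ doublings Q (suc k)

  data Part (x : ℕ) : Set where
    1·2^  : ∀ a → a ≤ k → x ≡ 1 * 2 ^ a → Part x
    P·2^  : ∀ a → a ≤ k → x ≡ P * 2 ^ a → Part x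
    Q·2^  : ∀ a → a ≤ k → x ≡ Q * 2 ^ a → Part x
    PQ·2^ : ∀ a → a < k → x ≡ P * Q * 2 ^ a → Part x

  ∈-parts⁻ : ∀ {x} → x ∈ parts → Part x
  ∈-parts⁻ x∈ with ∈-++⁻ (doublings (P * Q) k) x∈
  ... | inj₁ x∈PQ-run with ∈-doublings⁻ x∈PQ-run
  ...   | a , a<k , e = PQ·2^ a a<k e
  ∈-parts⁻ x∈ | inj₂ x∈₁ with ∈-++⁻ (doublings 1 (suc k)) x∈₁
  ... | inj₁ x∈1-run with ∈-doublings⁻ x∈1-run
  ...   | a , s≤s a≤k , e = 1·2^ a a≤k e
  ∈-parts⁻ x∈ | inj₂ x∈₁ | inj₂ x∈₂ with ∈-++⁻ (doublings P (suc k)) x∈₂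
  ... | inj₁ x∈P-run with ∈-doublings⁻ x∈P-run
  ...   | a , s≤s a≤k , e = P·2^ a a≤k e
  ∈-parts⁻ x∈ | inj₂ x∈₁ | inj₂ x∈₂ | inj₂ x∈Q-run with ∈-doublings⁻ x∈Q-run
  ...   | a , s≤s a≤k , e = Q·2^ a a≤k e

  ∈-parts⁺ : ∀ {x} → Part x → x ∈ parts
  ∈-parts⁺ (PQ·2^ a a<k refl) = ∈-++⁺ˡ (∈-doublings⁺ a<k)
  ∈-parts⁺ (1·2^ a a≤k refl)  = ∈-++⁺ʳ (doublings (P * Q) k) (∈-++⁺ˡ (∈-doublings⁺ (s≤s a≤k)))
  ∈-parts⁺ (P·2^ a a≤k refl)  = ∈-++⁺ʳ (doublings (P * Q) k) (∈-++⁺ʳ (doublings 1 (suc k))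
                                  (∈-++⁺ˡ (∈-doublings⁺ (s≤s a≤k))))
  ∈-parts⁺ (Q·2^ a a≤k refl)  = ∈-++⁺ʳ (doublings (P * Q) k) (∈-++⁺ʳ (doublings 1 (suc k))
                                  (∈-++⁺ʳ (doublings P (suc k)) (∈-doublings⁺ (s≤s a≤k))))

  1<2^* : ∀ b {r} → 1 < r → 1 < 2 ^ b * r
  1<2^* b {r} 1<r = <-≤-trans 1<r (m≤n*m r (2 ^ b) {{m^n≢0 2 b}})

  complete : ∀ c r {a} → a ≤ k → c * r ≡ P * Q → c * 2 ^ a * (2 ^ (k ∸ a) * r) ≡ n
  complete c r {a} a≤k cr≡PQ = begin
    c * 2 ^ a * (2 ^ (k ∸ a) * r) ≡⟨ regroup c (2 ^ a) (2 ^ (k ∸ a)) r ⟩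
    2 ^ a * 2 ^ (k ∸ a) * (c * r) ≡⟨ cong₂ _*_ (2^-split a≤k) cr≡PQ ⟩
    2 ^ k * (P * Q)               ≡⟨ sym (*-assoc (2 ^ k) P Q) ⟩
    n                             ∎
    where
    open ≡-Reasoning
    regroup : ∀ c x y r → c * x * (y * r) ≡ x * y * (c * r)
    regroup = solve-∀

  cofactor : ∀ {x} → Part x → Σ ℕ λ c → 1 < c × x * c ≡ n
  cofactor (1·2^ a a≤k refl)  = 2 ^ (k ∸ a) * (P * Q) , 1<2^* (k ∸ a) 1<PQ , complete 1 (P * Q) a≤k (*-identityˡ _)
    where
    1<PQ : 1 < P * Q
    1<PQ = <-≤-trans 1<P (m≤m*n P Q)
  cofactor (P·2^ a a≤k refl)  = 2 ^ (k ∸ a) * Q , 1<2^* (k ∸ a) 1<Q , complete P Q a≤k refl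
  cofactor (Q·2^ a a≤k refl)  = 2 ^ (k ∸ a) * P , 1<2^* (k ∸ a) 1<P , complete Q P a≤k (*-comm Q P)
  cofactor (PQ·2^ a a<k refl) = 2 ^ (k ∸ a) * 1 , 1<2^[k∸a]*1 , complete (P * Q) 1 (<⇒≤ a<k) (*-identityʳ _)
    where
    1<2^[k∸a]*1 : 1 < 2 ^ (k ∸ a) * 1
    1<2^[k∸a]*1 = subst (1 <_) (sym (*-identityʳ _)) (^-monoʳ-< 2 (s≤s (s≤s z≤n)) (m<n⇒0<n∸m a<k))

  part∣n : ∀ {x} → Part x → x ∣ n
  part∣n {x} part with cofactor part
  ... | c , _ , xc≡n = divides c (trans (sym xc≡n) (*-comm x c))

  part<n : ∀ {x} → Part x → x < n
  part<n {x} part with cofactor part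
  ... | c , 1<c , xc≡n = proper-factor x c 1<c xc≡n

  n≡Q·P·2^k : n ≡ Q * (P * 2 ^ k)
  n≡Q·P·2^k = reorder (2 ^ k) P Q
    where
    reorder : ∀ t p q → t * p * q ≡ q * (p * t)
    reorder = solve-∀

  -- Conversely, every proper divisor of n is a part: peel off the primes Q and P,
  -- leaving a divisor of 2^k.
  classify : ∀ {x} → x ∣ n → x < n → Part x
  classify {x} x∣n x<n with prime-divisor-split pQ (subst (x ∣_) n≡Q·P·2^k x∣n)
  ... | inj₁ (y , refl , y∣P·2^k) with prime-divisor-split pP y∣P·2^k
  ...   | inj₁ (z , refl , z∣2^k) with divisor-of-2^ k z∣2^k
  ...     | a , a≤k , refl with m≤n⇒m<n∨m≡n a≤k
  ...       | inj₁ a<k  = PQ·2^ a a<k (reorder (2 ^ a) P Q)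
    where
    reorder : ∀ t p q → q * (p * t) ≡ p * q * t
    reorder = solve-∀
  ...       | inj₂ refl = ⊥-elim (<-irrefl (sym n≡Q·P·2^k) x<n)
  classify x∣n x<n | inj₁ (y , refl , y∣P·2^k) | inj₂ y∣2^k with divisor-of-2^ k y∣2^k
  ... | a , a≤k , refl = Q·2^ a a≤k refl
  classify x∣n x<n | inj₂ x∣P·2^k with prime-divisor-split pP x∣P·2^k
  ... | inj₁ (y , refl , y∣2^k) with divisor-of-2^ k y∣2^k
  ...   | a , a≤k , refl = P·2^ a a≤k refl
  classify x∣n x<n | inj₂ x∣P·2^k | inj₂ x∣2^k with divisor-of-2^ k x∣2^k
  ... | a , a≤k , refl = 1·2^ a a≤k (sym (*-identityˡ _))

  -- The four runs are pairwise disjoint, told apart by divisibility by P and Q.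
  parts-unique : Unique parts
  parts-unique =
    Unique.++⁺ (doublings-unique (P * Q) k)
      (Unique.++⁺ (doublings-unique 1 (suc k))
        (Unique.++⁺ (doublings-unique P (suc k)) (doublings-unique Q (suc k)) P-run#Q-run)
        1-run#P,Q-runs)
      PQ-run#rest
    where
    P∣PQ-run : ∀ {x m} → x ∈ doublings (P * Q) m → P ∣ x
    P∣PQ-run x∈ = ∣-trans (m∣m*n Q) (doublings-multiple x∈)
    Q∣PQ-run : ∀ {x m} → x ∈ doublings (P * Q) m → Q ∣ x
    Q∣PQ-run x∈ = ∣-trans (n∣m*n P) (doublings-multiple x∈)
    P-run#Q-run : Disjoint (doublings P (suc k)) (doublings Q (suc k))
    P-run#Q-run = separated (doublings-multiple {m = suc k}) (prime∤doublings {m = suc k} pP 2<P P∤Q)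
    1-run#P,Q-runs : Disjoint (doublings 1 (suc k)) (doublings P (suc k) ++ doublings Q (suc k))
    1-run#P,Q-runs = disjoint-++
      (#-sym (separated (doublings-multiple {m = suc k}) (prime∤doublings {m = suc k} pP 2<P P∤1)))
      (#-sym (separated (doublings-multiple {m = suc k}) (prime∤doublings {m = suc k} pQ 2<Q Q∤1)))
    PQ-run#rest : Disjoint (doublings (P * Q) k) (doublings 1 (suc k) ++ doublings P (suc k) ++ doublings Q (suc k))
    PQ-run#rest = disjoint-++ (separated (Q∣PQ-run {m = k}) (prime∤doublings {m = suc k} pQ 2<Q Q∤1))
      (disjoint-++ (separated (Q∣PQ-run {m = k}) (prime∤doublings {m = suc k} pQ 2<Q Q∤P))
                   (separated (P∣PQ-run {m = k}) (prime∤doublings {m = suc k} pP 2<P P∤Q)))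

  aliquot⇒part : ∀ {x} → x ∈ aliquotParts n → Part x
  aliquot⇒part x∈ with ∈-aliquotParts⁻ n x∈
  ... | x∣n , x<n = classify x∣n x<n

  sum-aliquotParts : sum (aliquotParts n) ≡ sum parts
  sum-aliquotParts = unique-sum-≡ (aliquotParts-unique n) parts-unique
    (λ x∈ → ∈-parts⁺ (aliquot⇒part x∈))
    (λ x∈ → let part = ∈-parts⁻ x∈ in ∈-aliquotParts⁺ n (part∣n part) (part<n part))

  sum-parts : 2 * 2 ^ k * P + 2 * 2 ^ k * Q ≡ (P + 1) * (Q + 1) → sum parts ≡ n + 2 * 2 ^ k
  sum-parts identity = +-cancelʳ-≡ (P * Q + (1 + (P + Q))) _ _ (begin
    sum parts + (P * Q + (1 + (P + Q)))
      ≡⟨ cong (_+ (P * Q + (1 + (P + Q)))) split-sum ⟩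
    s[PQ] + (s[1] + (s[P] + s[Q])) + (P * Q + (1 + (P + Q)))
      ≡⟨ regroup s[PQ] s[1] s[P] s[Q] P Q ⟩
    (s[PQ] + P * Q) + ((s[1] + 1) + ((s[P] + P) + (s[Q] + Q)))
      ≡⟨ cong₂ _+_ (sum-doublings (P * Q) k)
           (cong₂ _+_ (sum-doublings 1 (suc k))
             (cong₂ _+_ (sum-doublings P (suc k)) (sum-doublings Q (suc k)))) ⟩
    P * Q * 2 ^ k + (1 * (2 * 2 ^ k) + (P * (2 * 2 ^ k) + Q * (2 * 2 ^ k)))
      ≡⟨ expand (2 ^ k) P Q ⟩
    n + 2 * 2 ^ k + (2 * 2 ^ k * P + 2 * 2 ^ k * Q)
      ≡⟨ cong (n + 2 * 2 ^ k +_) identity ⟩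
    n + 2 * 2 ^ k + (P + 1) * (Q + 1)
      ≡⟨ cong (n + 2 * 2 ^ k +_) (multiply-out P Q) ⟩
    n + 2 * 2 ^ k + (P * Q + (1 + (P + Q))) ∎)
    where
    open ≡-Reasoning
    s[PQ] s[1] s[P] s[Q] : ℕ
    s[PQ] = sum (doublings (P * Q) k)
    s[1]  = sum (doublings 1 (suc k))
    s[P]  = sum (doublings P (suc k))
    s[Q]  = sum (doublings Q (suc k))
    split-sum : sum parts ≡ s[PQ] + (s[1] + (s[P] + s[Q]))
    split-sum = trans (sum-++ (doublings (P * Q) k) _) (cong (s[PQ] +_)
                  (trans (sum-++ (doublings 1 (suc k)) _) (cong (s[1] +_)
                    (sum-++ (doublings P (suc k)) _))))
    regroup : ∀ a b c d p q → a + (b + (c + d)) + (p * q + (1 + (p + q))) ≡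
                              (a + p * q) + ((b + 1) + ((c + p) + (d + q)))
    regroup = solve-∀
    expand : ∀ t p q → p * q * t + (1 * (2 * t) + (p * (2 * t) + q * (2 * t))) ≡
                       t * p * q + 2 * t + (2 * t * p + 2 * t * q)
    expand = solve-∀
    multiply-out : ∀ p q → (p + 1) * (q + 1) ≡ p * q + (1 + (p + q))
    multiply-out = solve-∀

  -- A part of size at most 2^(k+1) < P, Q is a power of two 2^a with a ≤ k.
  small-part : ∀ {x} → x ≤ 2 * 2 ^ k → Part x → x ∈ doublings 1 (suc k)
  small-part x≤2T (1·2^ a a≤k refl)  = ∈-doublings⁺ (s≤s a≤k)
  small-part x≤2T (P·2^ a a≤k refl)  = ⊥-elim (<⇒≱ 2T<P (≤-trans (m≤m*n P (2 ^ a) {{m^n≢0 2 a}}) x≤2T))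
  small-part x≤2T (Q·2^ a a≤k refl)  = ⊥-elim (<⇒≱ 2T<Q (≤-trans (m≤m*n Q (2 ^ a) {{m^n≢0 2 a}}) x≤2T))
  small-part x≤2T (PQ·2^ a a<k refl) = ⊥-elim (<⇒≱ 2T<P (≤-trans (m≤m*n P Q) (≤-trans (m≤m*n (P * Q) (2 ^ a) {{m^n≢0 2 a}}) x≤2T)))

  weird : 2 * 2 ^ k * P + 2 * 2 ^ k * Q ≡ (P + 1) * (Q + 1) → Weird n
  weird identity = abundant , not-pseudoperfect
    where
    excess : sum (aliquotParts n) ≡ n + 2 * 2 ^ k
    excess = trans sum-aliquotParts (sum-parts identity)

    abundant : Abundant n
    abundant = begin-strict
      2 * n                      ≡⟨ cong (n +_) (+-identityʳ n) ⟩
      n + n                      <⟨ +-monoʳ-< n (m<m+n n (*-monoʳ-< 2 (m^n>0 2 k))) ⟩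
      n + (n + 2 * 2 ^ k)        ≡⟨ cong (n +_) (sym excess) ⟩
      n + sum (aliquotParts n)   ≡⟨ sym (σ-aliquot n) ⟩
      σ n                        ∎
      where open ≤-Reasoning

    -- The leftover C of a representation sums to 2T, yet it consists of distinct powers
    -- 2^a with a ≤ k, which sum to at most 2T − 1.
    not-pseudoperfect : ¬ Pseudoperfect n
    not-pseudoperfect pp with pseudoperfect⇒leftover n pp
    ... | C , C⊆ , e = <⇒≱ powers<sumC sumC≤powers
      where
      sumC≡2T : sum C ≡ 2 * 2 ^ k
      sumC≡2T = +-cancelˡ-≡ n _ _ (trans e excess)
      C⊆powers : ∀ {x} → x ∈ C → x ∈ doublings 1 (suc k)
      C⊆powers x∈C = small-part (subst (_ ≤_) sumC≡2T (∈⇒≤sum x∈C)) (aliquot⇒part (Any-resp-⊆ C⊆ x∈C))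
      sumC≤powers : sum C ≤ sum (doublings 1 (suc k))
      sumC≤powers = unique-sum-≤ (Unique-resp-⊆ C⊆ (aliquotParts-unique n)) C⊆powers
      powers<sumC : sum (doublings 1 (suc k)) < sum C
      powers<sumC = subst (sum (doublings 1 (suc k)) <_)
        (trans (trans (sum-doublings 1 (suc k)) (*-identityˡ _)) (sym sumC≡2T))
        (m<m+n _ (s≤s z≤n))

parity : ∀ m → (Σ ℕ λ w → m ≡ 2 * w) ⊎ (Σ ℕ λ w → m ≡ suc (2 * w))
parity zero = inj₁ (0 , refl)
parity (suc m) with parity m
... | inj₁ (w , refl) = inj₂ (w , refl)
... | inj₂ (w , refl) = inj₁ (suc w , cong suc (sym (+-suc w (w + 0))))

2-adic-unique : ∀ a b x y → 2 ^ a * suc (2 * x) ≡ 2 ^ b * suc (2 * y) → a ≡ b × suc (2 * x) ≡ suc (2 * y)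
2-adic-unique zero    zero    x y e = refl , trans (sym (*-identityˡ _)) (trans e (*-identityˡ _))
2-adic-unique zero    (suc b) x y e =
  ⊥-elim (even≢odd (2 ^ b * suc (2 * y)) x (trans (sym (*-assoc 2 (2 ^ b) _)) (trans (sym e) (*-identityˡ _))))
2-adic-unique (suc a) zero    x y e =
  ⊥-elim (even≢odd (2 ^ a * suc (2 * x)) y (trans (sym (*-assoc 2 (2 ^ a) _)) (trans e (*-identityˡ _))))
2-adic-unique (suc a) (suc b) x y e with 2-adic-unique a b x y
  (*-cancelˡ-≡ _ _ 2 (trans (sym (*-assoc 2 (2 ^ a) _)) (trans e (*-assoc 2 (2 ^ b) _))))
... | a≡b , odd-parts≡ = cong suc a≡b , odd-parts≡

odd-factor : ∀ {u v k} → 1 ≤ k → u * v + 1 ≡ 2 ^ k → Σ ℕ λ x → u ≡ suc (2 * x)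
odd-factor {u} {v} {suc k} _ uv+1≡2^k with parity u
... | inj₂ u-odd        = u-odd
... | inj₁ (w , refl)   = ⊥-elim (even≢odd (2 ^ k) (w * v) (sym (trans (reassociate w v) uv+1≡2^k)))
  where
  reassociate : ∀ w v → suc (2 * (w * v)) ≡ 2 * w * v + 1
  reassociate = solve-∀

-- An odd square plus one is 2 mod 4, so it is not a power of 4 other than 1.
odd-square+1≢4^ : ∀ x j → suc (2 * x) * suc (2 * x) + 1 ≢ 2 ^ (suc j + suc j)
odd-square+1≢4^ x j e = even≢odd (2 ^ j * 2 ^ j) (x + x * x) (*-cancelˡ-≡ _ _ 2 (sym (begin
    2 * suc (2 * (x + x * x))          ≡⟨ odd-square+1 x ⟩
    suc (2 * x) * suc (2 * x) + 1      ≡⟨ e ⟩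
    2 ^ (suc j + suc j)                ≡⟨ ^-distribˡ-+-* 2 (suc j) (suc j) ⟩
    (2 * 2 ^ j) * (2 * 2 ^ j)          ≡⟨ square-of-double (2 ^ j) ⟩
    2 * (2 * (2 ^ j * 2 ^ j))          ∎)))
  where
  open ≡-Reasoning
  odd-square+1 : ∀ x → 2 * suc (2 * (x + x * x)) ≡ suc (2 * x) * suc (2 * x) + 1
  odd-square+1 = solve-∀
  square-of-double : ∀ t → (2 * t) * (2 * t) ≡ 2 * (2 * (t * t))
  square-of-double = solve-∀

candidate : ℕ → ℕ → ℕ → ℕ
candidate k j w = (2 ^ (k + 1) ∸ 1) + 2 ^ (j + 1) * w

candidate+1 : ∀ k j w → candidate k j w + 1 ≡ 2 * 2 ^ k + 2 * 2 ^ j * w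
candidate+1 k j w = begin
    (2 ^ (k + 1) ∸ 1) + 2 ^ (j + 1) * w + 1  ≡⟨ move-1 (2 ^ (k + 1) ∸ 1) (2 ^ (j + 1) * w) ⟩
    (2 ^ (k + 1) ∸ 1) + 1 + 2 ^ (j + 1) * w  ≡⟨ cong₂ _+_ M+1≡2^[k+1] (cong (_* w) (2^[m+1] j)) ⟩
    2 * 2 ^ k + 2 * 2 ^ j * w                ∎
  where
  open ≡-Reasoning
  move-1 : ∀ a b → a + b + 1 ≡ a + 1 + b
  move-1 = solve-∀
  2^[m+1] : ∀ m → 2 ^ (m + 1) ≡ 2 * 2 ^ m
  2^[m+1] m = cong (2 ^_) (+-comm m 1)
  M+1≡2^[k+1] : (2 ^ (k + 1) ∸ 1) + 1 ≡ 2 * 2 ^ k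
  M+1≡2^[k+1] = trans (m∸n+n≡m (m^n>0 2 (k + 1))) (2^[m+1] k)

candidate-large : ∀ k j w → 1 ≤ w → 2 * 2 ^ k < candidate k j w
candidate-large k j w 1≤w = s≤s⁻¹ (begin
    2 + 2 * 2 ^ k              ≡⟨ +-comm 2 (2 * 2 ^ k) ⟩
    2 * 2 ^ k + 2              ≤⟨ +-monoʳ-≤ (2 * 2 ^ k) (*-mono-≤ (*-monoʳ-≤ 2 (m^n>0 2 j)) 1≤w) ⟩
    2 * 2 ^ k + 2 * 2 ^ j * w  ≡⟨ sym (candidate+1 k j w) ⟩
    candidate k j w + 1        ≡⟨ +-comm (candidate k j w) 1 ⟩
    1 + candidate k j w        ∎)
  where open ≤-Reasoning

-- If uv = 2^k − 1 then the two candidates differ: equality would force u = v odd and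
-- k = 2i with i ≥ 1, i.e. u² + 1 = 4^i, which is impossible.
candidates-distinct : ∀ k u v i → 1 ≤ k → i ≤ k → u * v + 1 ≡ 2 ^ k →
  candidate k i u ≢ candidate k (k ∸ i) v
candidates-distinct k u v i 1≤k i≤k uv+1≡2^k p≡q
  with odd-factor {u} {v} 1≤k uv+1≡2^k | odd-factor {v} {u} 1≤k (trans (cong (_+ 1) (*-comm v u)) uv+1≡2^k)
... | x , refl | y , refl
  with 2-adic-unique (i + 1) (k ∸ i + 1) x y (+-cancelˡ-≡ (2 ^ (k + 1) ∸ 1) _ _ p≡q)
... | i+1≡k∸i+1 , u≡v = no-power i (trans (cong (i +_) i≡k∸i) (m+[n∸m]≡n i≤k))
  where
  i≡k∸i : i ≡ k ∸ i
  i≡k∸i = +-cancelʳ-≡ 1 i (k ∸ i) i+1≡k∸i+1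
  u²+1≡2^k : suc (2 * x) * suc (2 * x) + 1 ≡ 2 ^ k
  u²+1≡2^k = trans (cong (λ w → suc (2 * x) * w + 1) u≡v) uv+1≡2^k
  no-power : ∀ h → h + h ≡ k → ⊥
  no-power zero    0≡k   = <⇒≢ 1≤k 0≡k
  no-power (suc j) j+j≡k = odd-square+1≢4^ x j (trans u²+1≡2^k (cong (2 ^_) (sym j+j≡k)))

-- With T = AB and uv + 1 = T, numbers P, Q with P + 1 = 2T + 2Au and Q + 1 = 2T + 2Bv
-- satisfy 2T(P + Q) = (P + 1)(Q + 1): both sides plus 4T equal 4T(2T + Au + Bv).
candidates-identity : ∀ A B u v T P Q → A * B ≡ T → u * v + 1 ≡ T →
  P + 1 ≡ 2 * T + 2 * A * u → Q + 1 ≡ 2 * T + 2 * B * v →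
  2 * T * P + 2 * T * Q ≡ (P + 1) * (Q + 1)
candidates-identity A B u v .(A * B) P Q refl uv+1≡T P+1≡ Q+1≡ = +-cancelʳ-≡ (4 * T) _ _ (begin
    2 * T * P + 2 * T * Q + 4 * T                               ≡⟨ shift-1 T P Q ⟩
    2 * T * (P + 1) + 2 * T * (Q + 1)                           ≡⟨ cong₂ (λ X Y → 2 * T * X + 2 * T * Y) P+1≡ Q+1≡ ⟩
    2 * T * (2 * T + 2 * A * u) + 2 * T * (2 * T + 2 * B * v)   ≡⟨ collect A B u v ⟩
    4 * T * (T + B * v + A * u + T)                             ≡⟨ cong (λ t → 4 * T * (T + B * v + A * u + t)) (sym uv+1≡T) ⟩
    4 * T * (T + B * v + A * u + (u * v + 1))                   ≡⟨ factor A B u v ⟩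
    (2 * T + 2 * A * u) * (2 * T + 2 * B * v) + 4 * T           ≡⟨ cong₂ (λ X Y → X * Y + 4 * T) (sym P+1≡) (sym Q+1≡) ⟩
    (P + 1) * (Q + 1) + 4 * T                                   ∎)
  where
  open ≡-Reasoning
  T : ℕ
  T = A * B
  shift-1 : ∀ t p q → 2 * t * p + 2 * t * q + 4 * t ≡ 2 * t * (p + 1) + 2 * t * (q + 1)
  shift-1 = solve-∀
  collect : ∀ a b u v → 2 * (a * b) * (2 * (a * b) + 2 * a * u) + 2 * (a * b) * (2 * (a * b) + 2 * b * v)
                        ≡ 4 * (a * b) * (a * b + b * v + a * u + a * b)
  collect = solve-∀
  factor : ∀ a b u v → 4 * (a * b) * (a * b + b * v + a * u + (u * v + 1))
                       ≡ (2 * (a * b) + 2 * a * u) * (2 * (a * b) + 2 * b * v) + 4 * (a * b)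
  factor = solve-∀

mainTheorem4 : (k u v i : ℕ) → 1 ≤ k → 1 ≤ u → 1 ≤ v → u * v ≡ 2 ^ k ∸ 1 → i ≤ k →
    Prime ((2 ^ (k + 1) ∸ 1) + 2 ^ (i + 1) * u) →
    Prime ((2 ^ (k + 1) ∸ 1) + 2 ^ (k ∸ i + 1) * v) →
    Weird (2 ^ k * ((2 ^ (k + 1) ∸ 1) + 2 ^ (i + 1) * u) * ((2 ^ (k + 1) ∸ 1) + 2 ^ (k ∸ i + 1) * v))
mainTheorem4 k u v i 1≤k 1≤u 1≤v uv≡2^k∸1 i≤k prime-p prime-q =
  TwoPrimes.weird k p q prime-p prime-q p≢q
    (candidate-large k i u 1≤u) (candidate-large k (k ∸ i) v 1≤v) identity
  where
  p q : ℕ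
  p = candidate k i u
  q = candidate k (k ∸ i) v
  uv+1≡2^k : u * v + 1 ≡ 2 ^ k
  uv+1≡2^k = trans (cong (_+ 1) uv≡2^k∸1) (m∸n+n≡m (m^n>0 2 k))
  p≢q : p ≢ q
  p≢q = candidates-distinct k u v i 1≤k i≤k uv+1≡2^k
  identity : 2 * 2 ^ k * p + 2 * 2 ^ k * q ≡ (p + 1) * (q + 1)
  identity = candidates-identity (2 ^ i) (2 ^ (k ∸ i)) u v (2 ^ k) p q (2^-split i≤k) uv+1≡2^k
    (candidate+1 k i u) (candidate+1 k (k ∸ i) v)
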